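{- Let $n\ge 2$. There is a bijection between spanning cycles of the $n$-Roberts graph (up to automorphisms of the graph) and loopless chord diagrams of a $2n$-gon (up to dihedral symmetry).
   Context: The $n$-Roberts graph has $2n$ vertices arranged as $n$ antipodal pairs (corresponding to pairs of opposite facets of the $n$-cube), with every pair of vertices joined by an edge except antipodal pairs. A chord diagram of a $2n$-gon is a perfect matching of its $2n$ vertices; a chord is a loop if it pairs two adjacent vertices of the polygon, and a diagram is loopless if it has no loops. Spanning cycles are considered up to the symmetries of the graph and chord diagrams up to rotations and reflections of the polygon. -}

module Defs where

open import Data.Nat using (ℕ; zero; suc; _+_; _*_; _∸_)
open import Data.Nat.DivMod using (_mod_)
open import Data.Fin using (Fin; toℕ)
open import Data.Bool using (Bool; true; false)
open import Data.Product using (Σ; ∃; _×_; _,_)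
open import Relation.Binary.PropositionalEquality using (_≡_; _≢_)
open import Relation.Nullary using (¬_)
open import Function.Bundles using (_↔_; Inverse)
open import Function.Definitions using (Bijective)

rotate : ∀ {m} → ℕ → Fin m → Fin m
rotate {zero} a ()
rotate {suc m} a k = (a + toℕ k) mod suc m

reflect : ∀ {m} → ℕ → Fin m → Fin m
reflect {zero} a ()
reflect {suc m} a k = (a + (suc m ∸ toℕ k)) mod suc m

next : ∀ {m} → Fin m → Fin m
next = rotate 1

-- an element of the dihedral group of the m-gon:
-- (a , false) is the rotation k ↦ a + k, (a , true) the reflection k ↦ a - k
Dihedral : Set
Dihedral = ℕ × Bool

act : ∀ {m} → Dihedral → Fin m → Fin m
act (a , false) k = rotate a k
act (a , true)  k = reflect a k

-- The n-Roberts graph: vertices (i , s), i : Fin n indexes the antipodal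
-- pair (pair of opposite facets of the n-cube), s : Bool the member of
-- the pair.  Two vertices are adjacent unless they are equal or antipodal,
-- i.e. iff they lie in different antipodal pairs.

RVertex : ℕ → Set
RVertex n = Fin n × Bool

RAdj : ∀ {n} → RVertex n → RVertex n → Set
RAdj (i , _) (j , _) = i ≢ j

record RAut (n : ℕ) : Set where
  field
    perm     : RVertex n ↔ RVertex n
    preserve : ∀ u v → RAdj u v → RAdj (Inverse.to perm u) (Inverse.to perm v)
    reflectA : ∀ u v → RAdj (Inverse.to perm u) (Inverse.to perm v) → RAdj u v

-- A spanning (Hamiltonian) cycle, presented as a cyclic listing of all
-- 2n vertices, consecutive ones (cyclically) being adjacent.
IsSpanningCycle : (n : ℕ) → (Fin (2 * n) → RVertex n) → Set
IsSpanningCycle n c = Bijective _≡_ _≡_ c × (∀ k → RAdj (c k) (c (next k)))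

SpanningCycle : ℕ → Set
SpanningCycle n = Σ (Fin (2 * n) → RVertex n) (IsSpanningCycle n)

-- Two listings give the same cycle up to graph automorphism iff they
-- differ by a graph automorphism composed with a dihedral reindexing
-- (rotation/reversal of the listing).
CycleEquiv : (n : ℕ) → SpanningCycle n → SpanningCycle n → Set
CycleEquiv n (c , _) (c' , _) =
  Σ (RAut n) λ σ → Σ Dihedral λ d →
    ∀ (k : Fin (2 * n)) → c' k ≡ Inverse.to (RAut.perm σ) (c (act d k))

-- Chord diagrams of a 2n-gon: perfect matchings of the vertices Fin (2n),
-- given as fixed-point-free involutions.  A loop is a chord joining two
-- adjacent polygon vertices k, k+1 (mod 2n).

IsLooplessChordDiagram : (n : ℕ) → (Fin (2 * n) → Fin (2 * n)) → Set
IsLooplessChordDiagram n μ =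
  (∀ k → μ (μ k) ≡ k) × (∀ k → μ k ≢ k) × (∀ k → μ k ≢ next k)

LooplessDiagram : ℕ → Set
LooplessDiagram n = Σ (Fin (2 * n) → Fin (2 * n)) (IsLooplessChordDiagram n)

DiagramEquiv : (n : ℕ) → LooplessDiagram n → LooplessDiagram n → Set
DiagramEquiv n (μ , _) (μ' , _) = Σ Dihedral λ d → ∀ (k : Fin (2 * n)) → act d (μ' k) ≡ μ (act d k)

-- A bijection between the quotients A/≈A and B/≈B, given by a map on
-- representatives that respects and reflects the equivalences and is
-- surjective up to equivalence.
QuotientBijection : (A B : Set) → (A → A → Set) → (B → B → Set) → Set
QuotientBijection A B _≈A_ _≈B_ =
  Σ (A → B) λ f →
    (∀ x y → (x ≈A y → f x ≈B f y) × (f x ≈B f y → x ≈A y)) ×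
    (∀ b → ∃ λ a → f a ≈B b)

module Submission where

-- A spanning cycle c of the n-Roberts graph lists its vertices Fin n × Bool
-- in cyclic order, i.e. it is a bijection from the polygon Fin (2n).  Pulling
-- the antipodal map (i , s) ↦ (i , not s) back along c gives a matching of
-- the polygon, the chord diagram of c; it is loopless because consecutive
-- vertices of the cycle are adjacent, i.e. never antipodal.  The key fact is
-- that the automorphisms of the Roberts graph are exactly the bijections
-- commuting with the antipodal map; hence two cycles differ by an
-- automorphism and a dihedral reindexing iff their diagrams differ by that
-- reindexing.  For surjectivity every fixed-point-free involution of
-- Fin (N + N) is shown conjugate to the antipodal map (remove one chord and
-- induct); the conjugating bijection is a cycle since the diagram is loopless.

open import Defs
open import Data.Nat using (ℕ; zero; suc; _+_; _*_; _∸_; _≤_; s≤s)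
open import Data.Nat.Properties
  using (+-comm; +-assoc; +-identityʳ; +-suc; suc-injective; m+[n∸m]≡n; <⇒≤; ≤-trans; m≤m+n)
open import Data.Nat.DivMod using (_%_; %-distribˡ-+; m%n%n≡m%n; n%n≡0; m%n<n; m<n⇒m%n≡m)
open import Data.Fin using (Fin; zero; suc; toℕ; punchIn; punchOut)
open import Data.Fin.Properties
  using (toℕ-fromℕ<; toℕ-injective; toℕ<n; _≟_; punchInᵢ≢i; punchIn-punchOut; punchOut-punchIn; punchOut-cong)
open import Data.Bool using (Bool; true; false; not)
open import Data.Product using (Σ; ∃; _×_; _,_; proj₁; proj₂)
open import Data.Sum as Sum using (_⊎_; inj₁; inj₂)
open import Data.Sum.Properties using (inj₂-injective)
open import Data.Sum.Function.Propositional using (_⊎-↔_)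
open import Data.Empty using (⊥-elim)
open import Function using (_∘_; id)
open import Function.Bundles using (_↔_; Inverse; Injection; Bijection; mk↔ₛ′; mk⤖)
open import Function.Definitions using (Injective)
open import Function.Construct.Composition using (_↔-∘_)
open import Function.Construct.Symmetry using (↔-sym)
open import Function.Construct.Identity using (↔-id)
open import Function.Properties.Bijection using (⤖⇒↔)
open import Function.Properties.Inverse using (Inverse⇒Injection; Inverse⇒Bijection)
open import Relation.Binary.PropositionalEquality
open import Relation.Nullary using (yes; no)
open import Relation.Nullary.Decidable using (decidable-stable)

open Inverse using (to; from; strictlyInverseˡ; strictlyInverseʳ)
open ≡-Reasoning

module Modular (m : ℕ) where

  M : ℕ
  M = suc m

  +-congˡ : ∀ z x y → x % M ≡ y % M → (z + x) % M ≡ (z + y) % M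
  +-congˡ z x y x≡y = begin
    (z + x) % M           ≡⟨ %-distribˡ-+ z x M ⟩
    (z % M + x % M) % M   ≡⟨ cong (λ r → (z % M + r) % M) x≡y ⟩
    (z % M + y % M) % M   ≡⟨ %-distribˡ-+ z y M ⟨
    (z + y) % M           ∎

  +-congʳ : ∀ z x y → x % M ≡ y % M → (x + z) % M ≡ (y + z) % M
  +-congʳ z x y x≡y = begin
    (x + z) % M   ≡⟨ cong (_% M) (+-comm x z) ⟩
    (z + x) % M   ≡⟨ +-congˡ z x y x≡y ⟩
    (z + y) % M   ≡⟨ cong (_% M) (+-comm z y) ⟩
    (y + z) % M   ∎

  neg : ℕ → ℕ
  neg x = M ∸ x % M

  neg-mod : ∀ x → neg (x % M) ≡ neg x
  neg-mod x = cong (M ∸_) (m%n%n≡m%n x M)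

  +-inverseʳ : ∀ x → (x + neg x) % M ≡ 0
  +-inverseʳ x = begin
    (x + neg x) % M       ≡⟨ +-congʳ (neg x) (x % M) x (m%n%n≡m%n x M) ⟨
    (x % M + neg x) % M   ≡⟨ cong (_% M) (m+[n∸m]≡n (<⇒≤ (m%n<n x M))) ⟩
    M % M                 ≡⟨ n%n≡0 M ⟩
    0                     ∎

  +-cancelʳ : ∀ z x y → (x + z) % M ≡ (y + z) % M → x % M ≡ y % M
  +-cancelʳ z x y eq = trans (sym (undo x)) (trans (+-congʳ (neg z) (x + z) (y + z) eq) (undo y))
    where
    undo : ∀ w → (w + z + neg z) % M ≡ w % M
    undo w = begin
      (w + z + neg z) % M     ≡⟨ cong (_% M) (+-assoc w z (neg z)) ⟩
      (w + (z + neg z)) % M   ≡⟨ +-congˡ w (z + neg z) 0 (+-inverseʳ z) ⟩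
      (w + 0) % M             ≡⟨ cong (_% M) (+-identityʳ w) ⟩
      w % M                   ∎

  toℕ-mod : (k : Fin M) → toℕ k % M ≡ toℕ k
  toℕ-mod k = m<n⇒m%n≡m (toℕ<n k)

  ≡-from-mod : {k l : Fin M} → toℕ k % M ≡ toℕ l % M → k ≡ l
  ≡-from-mod {k} {l} eq = toℕ-injective (trans (sym (toℕ-mod k)) (trans eq (toℕ-mod l)))

  toℕ-rotate : ∀ a (k : Fin M) → toℕ (rotate {M} a k) ≡ (a + toℕ k) % M
  toℕ-rotate a k = toℕ-fromℕ< (m%n<n (a + toℕ k) M)

  toℕ-reflect : ∀ a (k : Fin M) → toℕ (reflect {M} a k) ≡ (a + neg (toℕ k)) % M
  toℕ-reflect a k = trans (toℕ-fromℕ< (m%n<n (a + (M ∸ toℕ k)) M))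
                          (cong (λ r → (a + (M ∸ r)) % M) (sym (toℕ-mod k)))

  rotate-rotate : ∀ a b (k : Fin M) →
                  toℕ (rotate {M} b (rotate {M} a k)) % M ≡ (b + a + toℕ k) % M
  rotate-rotate a b k = begin
    toℕ (rotate b (rotate a k)) % M     ≡⟨ cong (_% M) (toℕ-rotate b (rotate a k)) ⟩
    (b + toℕ (rotate a k)) % M % M      ≡⟨ m%n%n≡m%n (b + toℕ (rotate a k)) M ⟩
    (b + toℕ (rotate a k)) % M          ≡⟨ +-congˡ b (toℕ (rotate a k)) (a + toℕ k) (trans (cong (_% M) (toℕ-rotate a k)) (m%n%n≡m%n (a + toℕ k) M)) ⟩
    (b + (a + toℕ k)) % M               ≡⟨ cong (_% M) (+-assoc b a (toℕ k)) ⟨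
    (b + a + toℕ k) % M                 ∎

  rotate-by : ∀ a b → (b + a) % M ≡ 0 → (k : Fin M) → rotate {M} b (rotate {M} a k) ≡ k
  rotate-by a b b+a≡0 k = ≡-from-mod (trans (rotate-rotate a b k) (+-congʳ (toℕ k) (b + a) 0 b+a≡0))

  rotate-zero : (k : Fin M) → rotate {M} 0 k ≡ k
  rotate-zero k = ≡-from-mod (trans (cong (_% M) (toℕ-rotate 0 k)) (m%n%n≡m%n (toℕ k) M))

  reflect-involutive : ∀ a (k : Fin M) → reflect {M} a (reflect {M} a k) ≡ k
  reflect-involutive a k = ≡-from-mod (begin
    toℕ (reflect a (reflect a k)) % M   ≡⟨ cong (_% M) (toℕ-reflect a (reflect a k)) ⟩
    (a + neg r) % M % M                 ≡⟨ m%n%n≡m%n (a + neg r) M ⟩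
    (a + neg r) % M                     ≡⟨ cong (λ t → (a + t) % M) neg-r≡neg-w ⟩
    (a + neg w) % M                     ≡⟨ +-cancelʳ (neg (toℕ k)) (a + neg w) (toℕ k) cancelled ⟩
    toℕ k % M                           ∎)
    where
    r w : ℕ
    r = toℕ (reflect a k)
    w = a + neg (toℕ k)
    neg-r≡neg-w : neg r ≡ neg w
    neg-r≡neg-w = trans (cong neg (toℕ-reflect a k)) (neg-mod w)
    cancelled : (a + neg w + neg (toℕ k)) % M ≡ (toℕ k + neg (toℕ k)) % M
    cancelled = begin
      (a + neg w + neg (toℕ k)) % M   ≡⟨ cong (_% M) (+-assoc a (neg w) (neg (toℕ k))) ⟩
      (a + (neg w + neg (toℕ k))) % M ≡⟨ cong (λ t → (a + t) % M) (+-comm (neg w) (neg (toℕ k))) ⟩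
      (a + (neg (toℕ k) + neg w)) % M ≡⟨ cong (_% M) (+-assoc a (neg (toℕ k)) (neg w)) ⟨
      (w + neg w) % M                 ≡⟨ +-inverseʳ w ⟩
      0                               ≡⟨ +-inverseʳ (toℕ k) ⟨
      (toℕ k + neg (toℕ k)) % M       ∎

  -- two distinct residues 0 ≠ 1 when M ≥ 2, so the successor moves every vertex
  next-moves : 2 ≤ M → (k : Fin M) → next k ≢ k
  next-moves (s≤s 1≤m) k next-k≡k = 1≢0 (begin
    1           ≡⟨ m<n⇒m%n≡m (s≤s 1≤m) ⟨
    1 % M       ≡⟨ +-cancelʳ (toℕ k) 1 0 (begin
                     (1 + toℕ k) % M       ≡⟨ toℕ-rotate 1 k ⟨
                     toℕ (next k)          ≡⟨ cong toℕ next-k≡k ⟩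
                     toℕ k                 ≡⟨ toℕ-mod k ⟨
                     (0 + toℕ k) % M       ∎) ⟩
    0           ∎)
    where
    1≢0 : 1 ≢ 0
    1≢0 ()

dihedral-inverse : ℕ → Dihedral → Dihedral
dihedral-inverse zero    d           = d
dihedral-inverse (suc m) (a , false) = (Modular.neg m a , false)
dihedral-inverse (suc m) (a , true)  = (a , true)

act-inverseʳ : ∀ {m} d (k : Fin m) → act d (act (dihedral-inverse m d) k) ≡ k
act-inverseʳ {suc m} (a , false) = Modular.rotate-by m (Modular.neg m a) a (Modular.+-inverseʳ m a)
act-inverseʳ {suc m} (a , true)  = Modular.reflect-involutive m a

act-inverseˡ : ∀ {m} d (k : Fin m) → act (dihedral-inverse m d) (act d k) ≡ k
act-inverseˡ {suc m} (a , false) =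
  Modular.rotate-by m a (Modular.neg m a)
    (trans (cong (_% suc m) (+-comm (Modular.neg m a) a)) (Modular.+-inverseʳ m a))
act-inverseˡ {suc m} (a , true)  = Modular.reflect-involutive m a

dihedral↔ : ∀ {m} → Dihedral → Fin m ↔ Fin m
dihedral↔ {m} d = mk↔ₛ′ (act d) (act (dihedral-inverse m d)) (act-inverseʳ d) (act-inverseˡ d)

act-identity : ∀ {m} (k : Fin m) → act (0 , false) k ≡ k
act-identity {suc m} = Modular.rotate-zero m

next-moves : ∀ {m} → 2 ≤ m → (k : Fin m) → next k ≢ k
next-moves {suc m} = Modular.next-moves m

private
  variable
    A B C : Set

record Intertwines (f : A → B) (α : A → A) (β : B → B) : Set where
  constructor intertwining
  field
    commutes : ∀ x → f (α x) ≡ β (f x)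

open Intertwines using (commutes)

intertwines-∘ : {f : A → B} {g : B → C} {α : A → A} {β : B → B} {γ : C → C} →
                Intertwines f α β → Intertwines g β γ → Intertwines (g ∘ f) α γ
intertwines-∘ {f = f} {g = g} f-αβ g-βγ =
  intertwining λ x → trans (cong g (commutes f-αβ x)) (commutes g-βγ (f x))

intertwines-from : (π : A ↔ B) {α : A → A} {β : B → B} →
                   Intertwines (to π) α β → Intertwines (from π) β α
intertwines-from π {α} {β} π-αβ = intertwining λ y → begin
  from π (β y)                 ≡⟨ cong (from π ∘ β) (strictlyInverseˡ π y) ⟨
  from π (β (to π (from π y))) ≡⟨ cong (from π) (commutes π-αβ (from π y)) ⟨
  from π (to π (α (from π y))) ≡⟨ strictlyInverseʳ π (α (from π y)) ⟩
  α (from π y)                 ∎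

intertwines-cancel : {f : A → B} {h : B → C} {α : A → A} {β : B → B} {γ : C → C} →
                     Injective _≡_ _≡_ h → Intertwines h β γ →
                     Intertwines (h ∘ f) α γ → Intertwines f α β
intertwines-cancel {f = f} h-inj h-βγ hf-αγ =
  intertwining λ x → h-inj (trans (commutes hf-αγ x) (sym (commutes h-βγ (f x))))

conjugate : A ↔ B → (A → A) → (B → B)
conjugate π α = to π ∘ α ∘ from π

conjugate-intertwines : (π : A ↔ B) (α : A → A) → Intertwines (to π) α (conjugate π α)
conjugate-intertwines π α = intertwining λ x → cong (to π ∘ α) (sym (strictlyInverseʳ π x))

to-injective : (π : A ↔ B) → Injective _≡_ _≡_ (to π)
to-injective π = Injection.injective (Inverse⇒Injection π)

IsMatching : (A → A) → Set
IsMatching α = (∀ x → α (α x) ≡ x) × (∀ x → α x ≢ x)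

conjugate-matching : (π : A ↔ B) {α : A → A} → IsMatching α → IsMatching (conjugate π α)
conjugate-matching π {α} (α-inv , α-fpf) = involutive , fixed-point-free
  where
  involutive : ∀ y → conjugate π α (conjugate π α y) ≡ y
  involutive y = begin
    to π (α (from π (to π (α (from π y))))) ≡⟨ cong (to π ∘ α) (strictlyInverseʳ π (α (from π y))) ⟩
    to π (α (α (from π y)))                 ≡⟨ cong (to π) (α-inv (from π y)) ⟩
    to π (from π y)                         ≡⟨ strictlyInverseˡ π y ⟩
    y                                       ∎
  fixed-point-free : ∀ y → conjugate π α y ≢ y
  fixed-point-free y fixed = α-fpf (from π y) (begin
    α (from π y)                 ≡⟨ strictlyInverseʳ π (α (from π y)) ⟨
    from π (to π (α (from π y))) ≡⟨ cong (from π) fixed ⟩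
    from π y                     ∎)

antipode : ∀ {N} → RVertex N → RVertex N
antipode (i , s) = (i , not s)

antipode-matching : ∀ {N} → IsMatching (antipode {N})
antipode-matching = involutive , fixed-point-free
  where
  involutive : ∀ v → antipode (antipode v) ≡ v
  involutive (i , false) = refl
  involutive (i , true)  = refl
  fixed-point-free : ∀ v → antipode v ≢ v
  fixed-point-free (i , false) ()
  fixed-point-free (i , true)  ()

same-pair⇒ : ∀ {N} (u v : RVertex N) → proj₁ u ≡ proj₁ v → v ≡ u ⊎ v ≡ antipode u
same-pair⇒ (i , false) (.i , false) refl = inj₁ refl
same-pair⇒ (i , false) (.i , true)  refl = inj₂ refl
same-pair⇒ (i , true)  (.i , false) refl = inj₂ refl
same-pair⇒ (i , true)  (.i , true)  refl = inj₁ refl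

⇒same-pair : ∀ {N} (u v : RVertex N) → v ≡ u ⊎ v ≡ antipode u → proj₁ u ≡ proj₁ v
⇒same-pair u v (inj₁ v≡u)  = cong proj₁ (sym v≡u)
⇒same-pair u v (inj₂ v≡u') = cong proj₁ (sym v≡u')

-- Graph automorphisms commute with the antipodal map: σ (antipode v) is
-- non-adjacent to σ v but differs from it.
automorphism-antipodal : ∀ {n} (σ : RAut n) → Intertwines (to (RAut.perm σ)) antipode antipode
automorphism-antipodal {n} σ = intertwining σ-antipodal
  where
  τ : RVertex n → RVertex n
  τ = to (RAut.perm σ)
  same-pair : ∀ v → proj₁ (τ v) ≡ proj₁ (τ (antipode v))
  same-pair v = decidable-stable (proj₁ (τ v) ≟ proj₁ (τ (antipode v)))
                  (λ adjacent → RAut.reflectA σ v (antipode v) adjacent refl)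
  σ-antipodal : ∀ v → τ (antipode v) ≡ antipode (τ v)
  σ-antipodal v with same-pair⇒ (τ v) (τ (antipode v)) (same-pair v)
  ... | inj₁ τv'≡τv  = ⊥-elim (proj₂ antipode-matching v (to-injective (RAut.perm σ) τv'≡τv))
  ... | inj₂ τv'≡τv' = τv'≡τv'

-- Conversely, every bijection commuting with the antipodal map is an
-- automorphism, since it maps each antipodal pair onto an antipodal pair.
antipodal-automorphism : ∀ {n} (τ : RVertex n ↔ RVertex n) →
                         Intertwines (to τ) antipode antipode → RAut n
antipodal-automorphism τ τ-antipodal =
  record { perm = τ ; preserve = preserves ; reflectA = reflects }
  where
  image-pair : ∀ u v → v ≡ u ⊎ v ≡ antipode u → to τ v ≡ to τ u ⊎ to τ v ≡ antipode (to τ u)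
  image-pair u v (inj₁ v≡u)  = inj₁ (cong (to τ) v≡u)
  image-pair u v (inj₂ v≡u') = inj₂ (trans (cong (to τ) v≡u') (commutes τ-antipodal u))
  preimage-pair : ∀ u v → to τ v ≡ to τ u ⊎ to τ v ≡ antipode (to τ u) → v ≡ u ⊎ v ≡ antipode u
  preimage-pair u v (inj₁ τv≡τu)  = inj₁ (to-injective τ τv≡τu)
  preimage-pair u v (inj₂ τv≡τu') = inj₂ (to-injective τ (trans τv≡τu' (sym (commutes τ-antipodal u))))
  preserves : ∀ u v → RAdj u v → RAdj (to τ u) (to τ v)
  preserves u v u≁v same =
    u≁v (⇒same-pair u v (preimage-pair u v (same-pair⇒ (to τ u) (to τ v) same)))
  reflects : ∀ u v → RAdj (to τ u) (to τ v) → RAdj u v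
  reflects u v τu≁τv same =
    τu≁τv (⇒same-pair (to τ u) (to τ v) (image-pair u v (same-pair⇒ u v same)))

module _ {N} {μ : A → A} (e : A ↔ RVertex N) (e-antipodal : Intertwines (to e) μ antipode) where

  labelled-same-pair : ∀ k l → proj₁ (to e k) ≡ proj₁ (to e l) → l ≡ k ⊎ l ≡ μ k
  labelled-same-pair k l same with same-pair⇒ (to e k) (to e l) same
  ... | inj₁ el≡ek  = inj₁ (to-injective e el≡ek)
  ... | inj₂ el≡ek' = inj₂ (to-injective e (trans el≡ek' (sym (commutes e-antipodal k))))

  matched-same-pair : ∀ k → proj₁ (to e k) ≡ proj₁ (to e (μ k))
  matched-same-pair k = ⇒same-pair (to e k) (to e (μ k)) (inj₂ (commutes e-antipodal k))

AntipodalLabelling : ℕ → (A → A) → Set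
AntipodalLabelling {A} N μ = Σ (A ↔ RVertex N) λ e → Intertwines (to e) μ antipode

module Restriction {X : Set} (α : Bool ⊎ X → Bool ⊎ X) (α-matching : IsMatching α)
                   (α-swaps : ∀ b → α (inj₁ b) ≡ inj₁ (not b)) where

  restrict : X → X
  restrict x = Sum.[ (λ _ → x) , id ] (α (inj₂ x))

  -- α cannot send inj₂ x into Bool: it would then send that point back to
  -- both inj₂ x and inj₁ (not b)
  restrict-spec : ∀ x → α (inj₂ x) ≡ inj₂ (restrict x)
  restrict-spec x with α (inj₂ x) in αx≡
  ... | inj₂ y = refl
  ... | inj₁ b with () ← trans (sym (proj₁ α-matching (inj₂ x))) (trans (cong α αx≡) (α-swaps b))

  α≗restrict : ∀ z → α z ≡ Sum.map not restrict z
  α≗restrict (inj₁ b) = α-swaps b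
  α≗restrict (inj₂ x) = restrict-spec x

  restrict-matching : IsMatching restrict
  restrict-matching = involutive , fixed-point-free
    where
    involutive : ∀ x → restrict (restrict x) ≡ x
    involutive x = inj₂-injective (begin
      inj₂ (restrict (restrict x)) ≡⟨ restrict-spec (restrict x) ⟨
      α (inj₂ (restrict x))        ≡⟨ cong α (restrict-spec x) ⟨
      α (α (inj₂ x))               ≡⟨ proj₁ α-matching (inj₂ x) ⟩
      inj₂ x                       ∎)
    fixed-point-free : ∀ x → restrict x ≢ x
    fixed-point-free x fixed = proj₂ α-matching (inj₂ x) (trans (restrict-spec x) (cong inj₂ fixed))

remove-two : ∀ {m} (p : Fin (suc m)) → Fin (suc (suc m)) ↔ (Bool ⊎ Fin m)
remove-two {m} p = mk↔ₛ′ split join split-join join-split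
  where
  split : Fin (suc (suc m)) → Bool ⊎ Fin m
  split zero = inj₁ false
  split (suc y) with p ≟ y
  ... | yes _   = inj₁ true
  ... | no p≢y = inj₂ (punchOut p≢y)
  join : Bool ⊎ Fin m → Fin (suc (suc m))
  join (inj₁ false) = zero
  join (inj₁ true)  = suc p
  join (inj₂ j)     = suc (punchIn p j)
  split-join : ∀ z → split (join z) ≡ z
  split-join (inj₁ false) = refl
  split-join (inj₁ true) with p ≟ p
  ... | yes _   = refl
  ... | no p≢p = ⊥-elim (p≢p refl)
  split-join (inj₂ j) with p ≟ punchIn p j
  ... | yes p≡pj = ⊥-elim (punchInᵢ≢i p j (sym p≡pj))
  ... | no _     = cong inj₂ (trans (punchOut-cong p refl) (punchOut-punchIn p))
  join-split : ∀ x → join (split x) ≡ x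
  join-split zero = refl
  join-split (suc y) with p ≟ y
  ... | yes refl = refl
  ... | no p≢y  = cong suc (punchIn-punchOut p≢y)

add-pair : ∀ {N} → (Bool ⊎ RVertex N) ↔ RVertex (suc N)
add-pair {N} = mk↔ₛ′ insert remove insert-remove remove-insert
  where
  insert : Bool ⊎ RVertex N → RVertex (suc N)
  insert (inj₁ s)       = (zero , s)
  insert (inj₂ (i , s)) = (suc i , s)
  remove : RVertex (suc N) → Bool ⊎ RVertex N
  remove (zero , s)  = inj₁ s
  remove (suc i , s) = inj₂ (i , s)
  insert-remove : ∀ v → insert (remove v) ≡ v
  insert-remove (zero , s)  = refl
  insert-remove (suc i , s) = refl
  remove-insert : ∀ z → remove (insert z) ≡ z
  remove-insert (inj₁ s)       = refl
  remove-insert (inj₂ (i , s)) = refl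

add-pair-antipodal : ∀ {N} → Intertwines (to (add-pair {N})) (Sum.map not antipode) antipode
add-pair-antipodal = intertwining λ where
  (inj₁ s)       → refl
  (inj₂ (i , s)) → refl

-- Induction step: remove the chord {0, μ 0}, label the rest, and give the
-- removed chord the new pair 0.
labelling-step : ∀ {N m} →
                 ((ν : Fin m → Fin m) → IsMatching ν → AntipodalLabelling N ν) →
                 (μ : Fin (suc (suc m)) → Fin (suc (suc m))) → IsMatching μ →
                 AntipodalLabelling (suc N) μ
labelling-step label-rest μ (μ-inv , μ-fpf) with μ zero in μ0≡
... | zero  = ⊥-elim (μ-fpf zero μ0≡)
... | suc p = add-pair ↔-∘ ((↔-id Bool ⊎-↔ e) ↔-∘ π) ,
              intertwines-∘ (intertwines-∘ π-antipodal ⊎-antipodal) add-pair-antipodal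
  where
  π : Fin (suc (suc _)) ↔ (Bool ⊎ Fin _)
  π = remove-two p
  swaps : ∀ b → conjugate π μ (inj₁ b) ≡ inj₁ (not b)
  swaps false = trans (cong (to π) μ0≡) (strictlyInverseˡ π (inj₁ true))
  swaps true  = cong (to π) (trans (cong μ (sym μ0≡)) (μ-inv zero))
  open Restriction (conjugate π μ) (conjugate-matching π (μ-inv , μ-fpf)) swaps
  rest : AntipodalLabelling _ restrict
  rest = label-rest restrict restrict-matching
  e : Fin _ ↔ RVertex _
  e = proj₁ rest
  π-antipodal : Intertwines (to π) μ (Sum.map not restrict)
  π-antipodal = intertwining λ x → trans (commutes (conjugate-intertwines π μ) x) (α≗restrict (to π x))
  ⊎-antipodal : Intertwines (Sum.map id (to e)) (Sum.map not restrict) (Sum.map not antipode)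
  ⊎-antipodal = intertwining λ where
    (inj₁ b) → refl
    (inj₂ x) → cong inj₂ (commutes (proj₂ rest) x)

antipodal-labelling : ∀ N m → m ≡ N + N → (μ : Fin m → Fin m) → IsMatching μ →
                      AntipodalLabelling N μ
antipodal-labelling zero    zero          _  μ _ =
  mk↔ₛ′ (λ ()) (λ { (() , _) }) (λ { (() , _) }) (λ ()) , intertwining λ ()
antipodal-labelling (suc N) (suc zero)    _  μ (_ , μ-fpf) = ⊥-elim (μ-fpf zero (only-point (μ zero)))
  where
  only-point : (k : Fin 1) → k ≡ zero
  only-point zero = refl
antipodal-labelling (suc N) (suc (suc m)) eq = labelling-step (antipodal-labelling N m m≡N+N)
  where
  m≡N+N : m ≡ N + N
  m≡N+N = suc-injective (trans (suc-injective eq) (+-suc N N))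

cycle↔ : ∀ {n} → SpanningCycle n → Fin (2 * n) ↔ RVertex n
cycle↔ (_ , bijective , _) = ⤖⇒↔ (mk⤖ bijective)

-- The chord diagram of a cycle joins the two positions at which the cycle
-- visits the same antipodal pair.
matchingOf : ∀ {n} → SpanningCycle n → Fin (2 * n) → Fin (2 * n)
matchingOf x = conjugate (↔-sym (cycle↔ x)) antipode

matchingOf-antipodal : ∀ {n} (x : SpanningCycle n) → Intertwines (proj₁ x) (matchingOf x) antipode
matchingOf-antipodal x =
  intertwines-from (↔-sym (cycle↔ x)) (conjugate-intertwines (↔-sym (cycle↔ x)) antipode)

-- It is loopless because consecutive vertices of the cycle are adjacent.
chordDiagram : ∀ {n} → SpanningCycle n → LooplessDiagram n
chordDiagram x@(c , _ , adjacent) = matchingOf x , proj₁ matching , proj₂ matching , loopless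
  where
  matching : IsMatching (matchingOf x)
  matching = conjugate-matching (↔-sym (cycle↔ x)) antipode-matching
  loopless : ∀ k → matchingOf x k ≢ next k
  loopless k matched =
    adjacent k (trans (matched-same-pair (cycle↔ x) (matchingOf-antipodal x) k)
                      (cong (proj₁ ∘ c) matched))

-- Cycles related by an automorphism and a reindexing d have chord diagrams
-- related by d: cancel the automorphism, which commutes with the antipode.
chordDiagram-respects : ∀ {n} (x y : SpanningCycle n) →
                        CycleEquiv n x y → DiagramEquiv n (chordDiagram x) (chordDiagram y)
chordDiagram-respects x@(c , _) y@(c' , _) (σ , d , c'≡σcd) =
  d , commutes (intertwines-cancel {f = act d} (to-injective (σ↔ ↔-∘ cycle↔ x)) σc-antipodal
                 (intertwining σcd-antipodal))
  where
  σ↔ : RVertex _ ↔ RVertex _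
  σ↔ = RAut.perm σ
  σc-antipodal : Intertwines (to σ↔ ∘ c) (matchingOf x) antipode
  σc-antipodal = intertwines-∘ (matchingOf-antipodal x) (automorphism-antipodal σ)
  σcd-antipodal : ∀ k → to σ↔ (c (act d (matchingOf y k))) ≡ antipode (to σ↔ (c (act d k)))
  σcd-antipodal k = begin
    to σ↔ (c (act d (matchingOf y k))) ≡⟨ c'≡σcd (matchingOf y k) ⟨
    c' (matchingOf y k)                ≡⟨ commutes (matchingOf-antipodal y) k ⟩
    antipode (c' k)                    ≡⟨ cong antipode (c'≡σcd k) ⟩
    antipode (to σ↔ (c (act d k)))     ∎

-- Conversely, if the diagrams are related by d, then c' ∘ d⁻¹ ∘ c⁻¹ commutes
-- with the antipode, hence is an automorphism relating the cycles.
chordDiagram-reflects : ∀ {n} (x y : SpanningCycle n) →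
                        DiagramEquiv n (chordDiagram x) (chordDiagram y) → CycleEquiv n x y
chordDiagram-reflects x@(c , _) y@(c' , _) (d , d-antipodal) =
  antipodal-automorphism τ τ-antipodal , d , reindex
  where
  x↔ : Fin _ ↔ RVertex _
  x↔ = cycle↔ x
  d↔ : Fin _ ↔ Fin _
  d↔ = dihedral↔ d
  τ : RVertex _ ↔ RVertex _
  τ = cycle↔ y ↔-∘ (↔-sym d↔ ↔-∘ ↔-sym x↔)
  τ-antipodal : Intertwines (to τ) antipode antipode
  τ-antipodal = intertwines-∘ (intertwines-∘ (intertwines-from x↔ (matchingOf-antipodal x))
                                            (intertwines-from d↔ (intertwining d-antipodal)))
                              (matchingOf-antipodal y)
  reindex : ∀ k → c' k ≡ to τ (c (act d k))
  reindex k = sym (begin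
    c' (from d↔ (from x↔ (c (act d k)))) ≡⟨ cong (c' ∘ from d↔) (strictlyInverseʳ x↔ (act d k)) ⟩
    c' (from d↔ (act d k))               ≡⟨ cong c' (strictlyInverseʳ d↔ k) ⟩
    c' k                                 ∎)

-- Every loopless diagram is the chord diagram of the cycle listing the
-- vertices of an antipodal labelling in polygon order.
chordDiagram-surjective : ∀ n → 2 ≤ n → (b : LooplessDiagram n) → ∃ λ x → DiagramEquiv n (chordDiagram x) b
chordDiagram-surjective n 2≤n (μ , μ-inv , μ-fpf , loopless) = x , (0 , false) , same-matching
  where
  labelling : AntipodalLabelling n μ
  labelling = antipodal-labelling n (2 * n) (cong (n +_) (+-identityʳ n)) μ (μ-inv , μ-fpf)
  e : Fin (2 * n) ↔ RVertex n
  e = proj₁ labelling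
  e-antipodal : Intertwines (to e) μ antipode
  e-antipodal = proj₂ labelling
  adjacent : ∀ k → RAdj (to e k) (to e (next k))
  adjacent k same with labelled-same-pair e e-antipodal k (next k) same
  ... | inj₁ next≡k = next-moves (≤-trans 2≤n (m≤m+n n (n + 0))) k next≡k
  ... | inj₂ next≡μ = loopless k (sym next≡μ)
  x : SpanningCycle n
  x = to e , Bijection.bijective (Inverse⇒Bijection e) , adjacent
  -- the labelling is the cycle, so its matching is μ itself
  μ≗matching : ∀ k → μ k ≡ matchingOf x k
  μ≗matching = commutes (intertwines-cancel {f = id} (to-injective e) (matchingOf-antipodal x) e-antipodal)
  same-matching : ∀ k → act (0 , false) (μ k) ≡ matchingOf x (act (0 , false) k)
  same-matching k = begin
    act (0 , false) (μ k)            ≡⟨ act-identity (μ k) ⟩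
    μ k                              ≡⟨ μ≗matching k ⟩
    matchingOf x k                   ≡⟨ cong (matchingOf x) (act-identity k) ⟨
    matchingOf x (act (0 , false) k) ∎

mainTheorem6 : (n : ℕ) → 2 ≤ n →
    QuotientBijection (SpanningCycle n) (LooplessDiagram n) (CycleEquiv n) (DiagramEquiv n)
mainTheorem6 n 2≤n =
  chordDiagram ,
  (λ x y → chordDiagram-respects x y , chordDiagram-reflects x y) ,
  chordDiagram-surjective n 2≤n
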